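{- Let $\mathcal A,\mathcal B,\mathcal C,\mathcal D$ be syntactical classes and let $\mathcal F,\mathcal G$ be countable families of (partial) functions $\mathbb N\to\mathbb N$, each with a fixed enumeration, which contain the identity function and are recursively closed by negative translation of the output and of the input (relative to these enumerations). For all total $e,f,g,h:\mathbb N\to\mathbb N$: (i) $e\ll^{\mathcal F}_{\mathcal B,\mathcal C} f$ and $f\ll^{\mathcal G}_{\mathcal C,\mathcal D} g$ imply $e\ll^{\mathcal G}_{\mathcal B,\mathcal D} g$; (ii) $e\ll^{\mathcal F\uparrow}_{\mathcal B,\mathcal C} f$ and $f\ll^{\mathcal G\uparrow}_{\mathcal C,\mathcal D} g$ imply $e\ll^{\mathcal F\uparrow}_{\mathcal B,\mathcal D} g$ and $e\ll^{\mathcal G\uparrow}_{\mathcal B,\mathcal D} g$; (iii) $e\le_{\rm ct} f$ and $f\ll^{\mathcal G}_{\mathcal C,\mathcal D} g$ imply $e\ll^{\mathcal G}_{\mathcal C,\mathcal D} g$; (iv) $e\le_{\rm ct} f$, $f\ll^{\mathcal G\uparrow}_{\mathcal C,\mathcal D} g$ and $g\le_{\rm ct} h$ imply $e\ll^{\mathcal G\uparrow}_{\mathcal C,\mathcal D} h$. In particular, (iii) and (iv) remain valid when $\le_{\rm ct}$ is replaced by $\ll^{\mathcal F}_{\mathcal A,\mathcal B}$ or by $\ll^{\mathcal F\uparrow}_{\mathcal A,\mathcal B}$. Moreover $\ll^{\mathcal F}_{\mathcal C,\mathcal D}$ and $\ll^{\mathcal F\uparrow}_{\mathcal C,\mathcal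 D}$ are strict orderings, and (v) $f\ll^{\mathcal F}_{\mathcal C,\mathcal D} g$ implies $f\ll^{\mathcal F\uparrow}_{\mathcal C,\mathcal D} g$, which implies $f<_{\rm ct} g$.
   Context: For total $f,g$: $f\le_{\rm ct} g$ iff $\exists c\,\forall x\ f(x)\le g(x)+c$; $f<_{\rm ct}g$ iff $f\le_{\rm ct}g$ and not $g\le_{\rm ct}f$. Syntactical classes. Fix a recursive pairing $\langle\cdot,\cdot\rangle$ and acceptable enumerations $(W_i)$ of r.e. subsets of $\mathbb N$ and of each $\mathbb N\times(\{0,1\}^*)^m$. A syntactical class is one of $\Sigma^0_1,\Pi^0_1,\Sigma^0_1\vee\Pi^0_1,\exists^{\le\mu}(\Sigma^0_1\wedge\Pi^0_1)$ (for a fixed total monotone increasing $\mu$), with enumeration of subsets of $\mathbb N$: $W^{\Sigma^0_1}_i=W_i$; $W^{\Pi^0_1}_i=\mathbb N\setminus W_i$; $W^{\Sigma^0_1\vee\Pi^0_1}_{\langle j,k\rangle}=W_j\cup(\mathbb N\setminus W_k)$; $W^{\exists^{\le\mu}(\Sigma^0_1\wedge\Pi^0_1)}_{\langle\langle j,k\rangle,m\rangle}=\{x:\exists u_1..u_m\in\{0,1\}^*(\forall l\ |u_l|\le\mu(x)\wedge(x,\vec u)\in W_j\setminus W_k)\}$ ($W_j,W_k$ r.e. subsets of $\mathbb N\times(\{0,1\}^*)^m$). Let $(\phi_i)$ enumerate $\mathcal F$. $f\prec^{\mathcal F}_{\mathcal C,\mathcal D}g$ means: (a) for every total $\phi\in\mathcal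 F$ tending to $+\infty$ there is a total recursive $\lambda$ such that whenever $W^{\mathcal C}_j$ is infinite, $W^{\mathcal D}_{\lambda(j)}$ is an infinite subset of $W^{\mathcal C}_j\cap\{x:f(x)<\phi(g(x))\}$; (b) there is a total recursive $\lambda:\mathbb N^2\to\mathbb N$ such that for all $i,j$, if $\phi_i$ is total and tends to $+\infty$ and $W^{\mathcal C}_j$ is infinite, then $W^{\mathcal D}_{\lambda(i,j)}$ is an infinite subset of $W^{\mathcal C}_j\cap\{x:f(x)<\phi_i(g(x))\}$. $\prec^{\mathcal F\uparrow}_{\mathcal C,\mathcal D}$ is the same with only monotone increasing $\phi,\phi_i$ considered. Finally $f\ll^{\mathcal F}_{\mathcal C,\mathcal D}g$ iff $f\prec^{\mathcal F}_{\mathcal C,\mathcal D}g$ and $f\le_{\rm ct}g$; $f\ll^{\mathcal F\uparrow}_{\mathcal C,\mathcal D}g$ iff $f\prec^{\mathcal F\uparrow}_{\mathcal C,\mathcal D}g$ and $f\le_{\rm ct}g$. Recursive closure: $\phi\in\mathcal F\Rightarrow\max(0,\phi-c)\in\mathcal F$ with a total recursive $\theta$ such that $\max(0,\phi_i-c)=\phi_{\theta(i,c)}$ (output); $\phi\in\mathcal F\Rightarrow(x\mapsto\phi(\max(0,x-c)))\in\mathcal F$ with a total recursive $\zeta$ such that $\phi_i(\max(0,x-c))=\phi_{\zeta(i,c)}(x)$ (input). -}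

module Defs where

open import Data.Nat using (ℕ; zero; suc; _+_; _*_; _∸_; _≤_; _<_)
open import Data.Fin using (Fin)
open import Data.Vec using (Vec; []; _∷_; lookup; map)
open import Data.Vec.Relation.Unary.All using (All)
open import Data.List using (List; length)
open import Data.Bool using (Bool; true; false)
open import Data.Maybe using (Maybe; just; nothing)
open import Data.Product using (Σ; ∃; ∃-syntax; _×_; _,_)
open import Data.Sum using (_⊎_)
open import Data.Unit using (⊤)
open import Relation.Nullary using (¬_)
open import Relation.Binary.PropositionalEquality using (_≡_)
open import Function.Bundles using (_⇔_)

data PR : ℕ → Set where
  zeroF : ∀ {n} → PR n
  succF : PR 1
  projF : ∀ {n} → Fin n → PR n
  compF : ∀ {n m} → PR m → Vec (PR n) m → PR n
  recF : ∀ {n} → PR n → PR (2 + n) → PR (1 + n)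
  minF : ∀ {n} → PR (1 + n) → PR n

mutual
  data Eval : ∀ {n} → PR n → Vec ℕ n → ℕ → Set where
    evZ : ∀ {n} {xs : Vec ℕ n} → Eval zeroF xs 0
    evS : ∀ {x} → Eval succF (x ∷ []) (suc x)
    evP : ∀ {n} {xs : Vec ℕ n} (i : Fin n) → Eval (projF i) xs (lookup xs i)
    evC : ∀ {n m} {f : PR m} {gs : Vec (PR n) m} {xs ys y} →
          EvalAll gs xs ys → Eval f ys y → Eval (compF f gs) xs y
    evR0 : ∀ {n} {f : PR n} {g : PR (2 + n)} {xs y} →
           Eval f xs y → Eval (recF f g) (0 ∷ xs) y
    evRs : ∀ {n} {f : PR n} {g : PR (2 + n)} {xs k y z} →
           Eval (recF f g) (k ∷ xs) y → Eval g (k ∷ y ∷ xs) z →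
           Eval (recF f g) (suc k ∷ xs) z
    evM : ∀ {n} {f : PR (1 + n)} {xs k} →
          Eval f (k ∷ xs) 0 →
          (∀ i → i < k → Σ ℕ (λ v → Eval f (i ∷ xs) (suc v))) →
          Eval (minF f) xs k

  data EvalAll : ∀ {n m} → Vec (PR n) m → Vec ℕ n → Vec ℕ m → Set where
    []  : ∀ {n} {xs : Vec ℕ n} → EvalAll [] xs []
    _∷_ : ∀ {n m} {g : PR n} {gs : Vec (PR n) m} {xs y ys} →
          Eval g xs y → EvalAll gs xs ys → EvalAll (g ∷ gs) xs (y ∷ ys)

Halts : ∀ {n} → PR n → Vec ℕ n → Set
Halts p xs = Σ ℕ (λ y → Eval p xs y)

TotRec₁ : (ℕ → ℕ) → Set
TotRec₁ f = Σ (PR 1) (λ p → ∀ x → Eval p (x ∷ []) (f x))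

TotRec₂ : (ℕ → ℕ → ℕ) → Set
TotRec₂ f = Σ (PR 2) (λ p → ∀ x y → Eval p (x ∷ y ∷ []) (f x y))

-- Binary words coded bijectively as natural numbers (bijective base 2)

encW : List Bool → ℕ
encW List.[] = 0
encW (false List.∷ w) = 1 + 2 * encW w
encW (true  List.∷ w) = 2 + 2 * encW w

-- Enumerations of r.e. sets; acceptability (Rogers: the enumeration is
-- itself r.e., and every r.e. enumeration reduces to it via a total
-- recursive translation of indices).

-- an enumeration (W i) of subsets of ℕ, written  W i x  for  x ∈ W_i
IsRE-Enum : (ℕ → ℕ → Set) → Set
IsRE-Enum W = Σ (PR 2) (λ p → ∀ i x → W i x ⇔ Halts p (i ∷ x ∷ []))

Acceptable : (ℕ → ℕ → Set) → Set₁
Acceptable W = IsRE-Enum W ×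
  ((V : ℕ → ℕ → Set) → IsRE-Enum V →
     Σ (ℕ → ℕ) (λ t → TotRec₁ t × (∀ i x → V i x ⇔ W (t i) x)))

IsRE-EnumT : (m : ℕ) → (ℕ → ℕ → Vec (List Bool) m → Set) → Set
IsRE-EnumT m W = Σ (PR (2 + m))
  (λ p → ∀ i x us → W i x us ⇔ Halts p (i ∷ x ∷ map encW us))

AcceptableT : (m : ℕ) → (ℕ → ℕ → Vec (List Bool) m → Set) → Set₁
AcceptableT m W = IsRE-EnumT m W ×
  ((V : ℕ → ℕ → Vec (List Bool) m → Set) → IsRE-EnumT m V →
     Σ (ℕ → ℕ) (λ t → TotRec₁ t × (∀ i x us → V i x us ⇔ W (t i) x us)))

record Setting : Set₁ where
  field
    pair     : ℕ → ℕ → ℕ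
    pairRec  : TotRec₂ pair
    pairInj  : ∀ a b c d → pair a b ≡ pair c d → (a ≡ c) × (b ≡ d)
    pairSurj : ∀ n → Σ ℕ (λ a → Σ ℕ (λ b → pair a b ≡ n))
    W        : ℕ → ℕ → Set
    W-acc    : Acceptable W
    WT       : (m : ℕ) → ℕ → ℕ → Vec (List Bool) m → Set
    WT-acc   : (m : ℕ) → AcceptableT m (WT m)

MonotoneFn : (ℕ → ℕ) → Set
MonotoneFn μ = ∀ {x y} → x ≤ y → μ x ≤ μ y

data SynClass : Set where
  Σ⁰₁   : SynClass
  Π⁰₁   : SynClass
  Σ⁰₁∨Π⁰₁ : SynClass
  ∃≤[_]Σ∧Π : (μ : ℕ → ℕ) → MonotoneFn μ → SynClass

-- WC S 𝒞 i x  :  x ∈ W^𝒞_i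
WC : Setting → SynClass → ℕ → ℕ → Set
WC S Σ⁰₁ i x = Setting.W S i x
WC S Π⁰₁ i x = ¬ Setting.W S i x
WC S Σ⁰₁∨Π⁰₁ i x = Σ ℕ λ j → Σ ℕ λ k →
  (Setting.pair S j k ≡ i) × (Setting.W S j x ⊎ ¬ Setting.W S k x)
WC S (∃≤[ μ ]Σ∧Π _) i x = Σ ℕ λ j → Σ ℕ λ k → Σ ℕ λ m →
  (Setting.pair S (Setting.pair S j k) m ≡ i) ×
  Σ (Vec (List Bool) m) (λ us →
     All (λ u → length u ≤ μ x) us ×
     Setting.WT S m j x us × ¬ Setting.WT S m k x us)

PFun : Set
PFun = ℕ → Maybe ℕ

Fam : Set
Fam = ℕ → PFun

TotalP : PFun → Set
TotalP φ = ∀ x → Σ ℕ (λ y → φ x ≡ just y)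

TendsInf : PFun → Set
TendsInf φ = ∀ N → Σ ℕ (λ M → ∀ x y → M ≤ x → φ x ≡ just y → N ≤ y)

MonotoneP : PFun → Set
MonotoneP φ = ∀ x x' y y' → x ≤ x' → φ x ≡ just y → φ x' ≡ just y' → y ≤ y'

mapM : (ℕ → ℕ) → Maybe ℕ → Maybe ℕ
mapM h (just y) = just (h y)
mapM h nothing  = nothing

-- contains identity, recursively closed by negative translation of
-- output and of input
record FamOK (Φ : Fam) : Set where
  field
    hasId    : Σ ℕ (λ i → ∀ x → Φ i x ≡ just x)
    θ        : ℕ → ℕ → ℕ
    θ-rec    : TotRec₂ θ
    θ-spec   : ∀ i c x → Φ (θ i c) x ≡ mapM (λ y → y ∸ c) (Φ i x)
    ζ        : ℕ → ℕ → ℕ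
    ζ-rec    : TotRec₂ ζ
    ζ-spec   : ∀ i c x → Φ (ζ i c) x ≡ Φ i (x ∸ c)

_≤ct_ : (ℕ → ℕ) → (ℕ → ℕ) → Set
f ≤ct g = Σ ℕ (λ c → ∀ x → f x ≤ g x + c)

_<ct_ : (ℕ → ℕ) → (ℕ → ℕ) → Set
f <ct g = (f ≤ct g) × ¬ (g ≤ct f)

Infinite : (ℕ → Set) → Set
Infinite A = ∀ N → Σ ℕ (λ x → N ≤ x × A x)

InfSubsetOf : (ℕ → Set) → (ℕ → Set) → Set
InfSubsetOf B A = Infinite B × (∀ x → B x → A x)

LtApp : (ℕ → ℕ) → (ℕ → ℕ) → PFun → ℕ → Set
LtApp f g φ x = Σ ℕ (λ y → (φ (g x) ≡ just y) × f x < y)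

Considered : Bool → PFun → Set
Considered false φ = TotalP φ × TendsInf φ
Considered true  φ = TotalP φ × TendsInf φ × MonotoneP φ

-- f ≺^Φ_{𝒞,𝒟} g   (mono = false)   and   f ≺^{Φ↑}_{𝒞,𝒟} g   (mono = true)
Prec : Setting → Bool → Fam → SynClass → SynClass → (ℕ → ℕ) → (ℕ → ℕ) → Set
Prec S mono Φ 𝒞 𝒟 f g =
  (∀ i → Considered mono (Φ i) →
     Σ (ℕ → ℕ) λ λf → TotRec₁ λf ×
       (∀ j → Infinite (WC S 𝒞 j) →
          InfSubsetOf (WC S 𝒟 (λf j)) (λ x → WC S 𝒞 j x × LtApp f g (Φ i) x)))
  ×
  (Σ (ℕ → ℕ → ℕ) λ λf → TotRec₂ λf ×
     (∀ i j → Considered mono (Φ i) → Infinite (WC S 𝒞 j) →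
        InfSubsetOf (WC S 𝒟 (λf i j)) (λ x → WC S 𝒞 j x × LtApp f g (Φ i) x)))

-- f ≪^Φ_{𝒞,𝒟} g   (mono = false)   and   f ≪^{Φ↑}_{𝒞,𝒟} g   (mono = true)
LL : Setting → Bool → Fam → SynClass → SynClass → (ℕ → ℕ) → (ℕ → ℕ) → Set
LL S mono Φ 𝒞 𝒟 f g = Prec S mono Φ 𝒞 𝒟 f g × (f ≤ct g)

StrictOrder : ((ℕ → ℕ) → (ℕ → ℕ) → Set) → Set
StrictOrder _<<_ = (∀ f → ¬ (f << f)) × (∀ f g h → f << g → g << h → f << h)

-- A witness of f ≺ g supplies, recursively in an index of φ, a recursive map
-- shrinking each infinite set of the source class to an infinite subset in
-- the target class on which f < φ ∘ g.  Transitivity composes two such maps: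
-- one relation is used at φ = id, where it only says that the smaller
-- function is pointwise smaller, and the other at the given φ; using the
-- first relation at φ and the second at id needs φ monotone.  A slack
-- e ≤ f + c is absorbed by replacing φ with φ ∸ c, and a slack g ≤ h + d by
-- replacing φ with φ(· ∸ d), which is sound only for monotone φ; the closure
-- hypotheses make both replacements recursive in the index.  Irreflexivity,
-- and ¬ g ≤ct f when f ≪↑ g, follow by using φ = id, resp. id ∸ c, on the
-- full set of the class.
module Submission where

open import Defs
open import Data.Nat using (ℕ; zero; suc; _+_; _∸_; _≤_; _<_; s≤s)
open import Data.Nat.Properties
open import Data.Bool using (Bool; true; false)
open import Data.Product using (Σ; _×_; _,_; proj₂)
open import Data.Sum using (_⊎_; inj₁; inj₂)
open import Data.Fin using () renaming (zero to fzero; suc to fsuc)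
open import Data.Vec using (Vec; []; _∷_)
open import Data.Vec.Relation.Unary.All using ([])
open import Data.List using (List)
open import Data.Maybe using (just)
open import Data.Maybe.Properties using (just-injective)
open import Data.Unit using (⊤; tt)
open import Data.Empty using (⊥)
open import Relation.Nullary using (¬_)
open import Relation.Binary.PropositionalEquality
  using (_≡_; _≗_; refl; sym; trans; cong; subst; subst₂)
open import Function using (id; _∘_)
open import Function.Bundles using (mk⇔; Equivalence)

constPR : ∀ {n} → ℕ → PR n
constPR zero    = zeroF
constPR (suc c) = compF succF (constPR c ∷ [])

eval-constPR : ∀ {n} c (xs : Vec ℕ n) → Eval (constPR c) xs c
eval-constPR zero    xs = evZ
eval-constPR (suc c) xs = evC (eval-constPR c xs ∷ []) evS

divergePR : ∀ {n} → PR n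
divergePR = minF (compF succF (projF fzero ∷ []))

divergePR-¬halts : ∀ {n} (xs : Vec ℕ n) → ¬ Halts divergePR xs
divergePR-¬halts xs (_ , evM (evC (_ ∷ []) ()) _)

TotRec₁-id : TotRec₁ id
TotRec₁-id = projF fzero , λ x → evP fzero

TotRec₁-∘ : ∀ {a b} → TotRec₁ a → TotRec₁ b → TotRec₁ (a ∘ b)
TotRec₁-∘ {b = b} (p , p-spec) (q , q-spec) =
  compF p (q ∷ []) , λ x → evC (q-spec x ∷ []) (p-spec (b x))

TotRec₁-∘₂ : ∀ {a b} → TotRec₁ a → TotRec₂ b → TotRec₂ (λ x y → a (b x y))
TotRec₁-∘₂ {b = b} (p , p-spec) (q , q-spec) =
  compF p (q ∷ []) , λ x y → evC (q-spec x y ∷ []) (p-spec (b x y))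

TotRec₂-∘ : ∀ {b σ τ} → TotRec₂ b → TotRec₁ σ → TotRec₁ τ →
  TotRec₂ (λ x y → b (σ x) (τ y))
TotRec₂-∘ {σ = σ} {τ} (p , p-spec) (q , q-spec) (r , r-spec) =
  compF p (compF q (projF fzero ∷ []) ∷ compF r (projF (fsuc fzero) ∷ []) ∷ []) ,
  λ x y → evC (evC (evP fzero ∷ []) (q-spec x) ∷ evC (evP (fsuc fzero) ∷ []) (r-spec y) ∷ [])
              (p-spec (σ x) (τ y))

TotRec₂-fixʳ : ∀ {t} c → TotRec₂ t → TotRec₁ (λ x → t x c)
TotRec₂-fixʳ c (p , p-spec) =
  compF p (projF fzero ∷ constPR c ∷ []) ,
  λ x → evC (evP fzero ∷ eval-constPR c _ ∷ []) (p-spec x c)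

module _ {W : ℕ → ℕ → Set} (acc : Acceptable W) where

  full-index : Σ ℕ λ j → ∀ x → W j x
  full-index =
    let (t , _ , t-spec) = proj₂ acc (λ _ _ → ⊤) (zeroF , λ _ _ → mk⇔ (λ _ → 0 , evZ) (λ _ → tt))
    in t 0 , λ x → Equivalence.to (t-spec 0 x) tt

  empty-index : Σ ℕ λ j → ∀ x → ¬ W j x
  empty-index =
    let (t , _ , t-spec) = proj₂ acc (λ _ _ → ⊥) (divergePR , λ _ _ → mk⇔ (λ ()) (divergePR-¬halts _))
    in t 0 , λ x → Equivalence.from (t-spec 0 x)

module _ {m} {W : ℕ → ℕ → Vec (List Bool) m → Set} (acc : AcceptableT m W) where

  fullT-index : Σ ℕ λ j → ∀ x us → W j x us
  fullT-index =
    let (t , _ , t-spec) =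
          proj₂ acc (λ _ _ _ → ⊤) (zeroF , λ _ _ _ → mk⇔ (λ _ → 0 , evZ) (λ _ → tt))
    in t 0 , λ x us → Equivalence.to (t-spec 0 x us) tt

  emptyT-index : Σ ℕ λ j → ∀ x us → ¬ W j x us
  emptyT-index =
    let (t , _ , t-spec) =
          proj₂ acc (λ _ _ _ → ⊥) (divergePR , λ _ _ _ → mk⇔ (λ ()) (divergePR-¬halts _))
    in t 0 , λ x us → Equivalence.from (t-spec 0 x us)

WC-full : ∀ S 𝒞 → Σ ℕ λ j → ∀ x → WC S 𝒞 j x
WC-full S Σ⁰₁ = full-index (Setting.W-acc S)
WC-full S Π⁰₁ = empty-index (Setting.W-acc S)
WC-full S Σ⁰₁∨Π⁰₁ =
  let (j , j-full) = full-index (Setting.W-acc S)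
  in Setting.pair S j 0 , λ x → j , 0 , refl , inj₁ (j-full x)
-- with m = 0 there is nothing to quantify over, and W_j ∖ W_k is everything
WC-full S (∃≤[ _ ]Σ∧Π _) =
  let (j , j-full)  = fullT-index (Setting.WT-acc S 0)
      (k , k-empty) = emptyT-index (Setting.WT-acc S 0)
  in Setting.pair S (Setting.pair S j k) 0 ,
     λ x → j , k , 0 , refl , [] , [] , j-full x [] , k-empty x []

WC-infinite : ∀ S 𝒞 → Σ ℕ λ j → Infinite (WC S 𝒞 j)
WC-infinite S 𝒞 = let (j , j-full) = WC-full S 𝒞 in j , λ N → N , ≤-refl , j-full N

InfSubsetOf-weaken : ∀ {A B C : ℕ → Set} →
  (∀ x → B x → C x) → InfSubsetOf A B → InfSubsetOf A C
InfSubsetOf-weaken B⊆C (A-inf , A⊆B) = A-inf , λ x → B⊆C x ∘ A⊆B x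

InfSubsetOf-witness : ∀ {A B : ℕ → Set} → InfSubsetOf A B → Σ ℕ B
InfSubsetOf-witness (A-inf , A⊆B) = let (x , _ , a) = A-inf 0 in x , A⊆B x a

record Refines (V W : ℕ → ℕ → Set) (P : ℕ → Set) (ℓ : ℕ → ℕ) : Set where
  constructor refines
  field
    refine : ∀ j → Infinite (V j) → InfSubsetOf (W (ℓ j)) (λ x → V j x × P x)
open Refines

RecRefinement : (ℕ → ℕ → Set) → (ℕ → ℕ → Set) → (ℕ → Set) → Set
RecRefinement V W P = Σ (ℕ → ℕ) λ ℓ → TotRec₁ ℓ × Refines V W P ℓ

Refines-weaken : ∀ {V W} {P Q : ℕ → Set} {ℓ} →
  (∀ x → P x → Q x) → Refines V W P ℓ → Refines V W Q ℓ
Refines-weaken P⊆Q r =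
  refines λ j V-inf → InfSubsetOf-weaken (λ x (v , p) → v , P⊆Q x p) (refine r j V-inf)

Refines-∘ : ∀ {U V W P Q ℓ ℓ′} → Refines U V P ℓ → Refines V W Q ℓ′ →
  Refines U W (λ x → P x × Q x) (ℓ′ ∘ ℓ)
Refines-∘ r r′ = refines λ j U-inf →
  let (V-inf , V⊆U∩P) = refine r j U-inf
  in InfSubsetOf-weaken (λ x (v , q) → let (u , p) = V⊆U∩P x v in u , p , q)
       (refine r′ _ V-inf)

RecRefinement-id : ∀ {V} → RecRefinement V V (λ _ → ⊤)
RecRefinement-id = id , TotRec₁-id , refines λ j V-inf → V-inf , λ x v → v , tt

Prec-refinement : ∀ {S} mono {Φ} 𝒞 𝒟 {f g} → Prec S mono Φ 𝒞 𝒟 f g →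
  ∀ i → Considered mono (Φ i) → RecRefinement (WC S 𝒞) (WC S 𝒟) (LtApp f g (Φ i))
Prec-refinement mono 𝒞 𝒟 (uniform , _) i i-cons =
  let (ℓ , ℓ-rec , r) = uniform i i-cons in ℓ , ℓ-rec , refines r

Considered-map : ∀ {φ ψ} → (TotalP φ → TotalP ψ) → (TendsInf φ → TendsInf ψ) →
  (MonotoneP φ → MonotoneP ψ) → ∀ mono → Considered mono φ → Considered mono ψ
Considered-map total tends _        false (tot , lim)       = total tot , tends lim
Considered-map total tends monotone true  (tot , lim , mon) = total tot , tends lim , monotone mon

Considered↑⇒Considered : ∀ mono {φ} → Considered true φ → Considered mono φ
Considered↑⇒Considered false (tot , lim , _) = tot , lim
Considered↑⇒Considered true  cons            = cons

Below : ℕ → PFun → ℕ → Set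
Below a φ b = Σ ℕ λ y → φ b ≡ just y × a < y

module _ {φ ψ : PFun} (φ≗ψ : φ ≗ ψ) where

  TotalP-resp : TotalP φ → TotalP ψ
  TotalP-resp tot x = let (y , φx≡y) = tot x in y , trans (sym (φ≗ψ x)) φx≡y

  TendsInf-resp : TendsInf φ → TendsInf ψ
  TendsInf-resp lim N =
    let (M , M-spec) = lim N in M , λ x y M≤x ψx≡y → M-spec x y M≤x (trans (φ≗ψ x) ψx≡y)

  MonotoneP-resp : MonotoneP φ → MonotoneP ψ
  MonotoneP-resp mon x x′ y y′ x≤x′ e e′ = mon x x′ y y′ x≤x′ (trans (φ≗ψ x) e) (trans (φ≗ψ x′) e′)

  Considered-resp : ∀ mono → Considered mono φ → Considered mono ψ
  Considered-resp = Considered-map TotalP-resp TendsInf-resp MonotoneP-resp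

  Below-resp : ∀ {a b} → Below a φ b → Below a ψ b
  Below-resp {b = b} (y , φb≡y , a<y) = y , trans (sym (φ≗ψ b)) φb≡y , a<y

Considered-id : ∀ mono {φ} → φ ≗ just → Considered mono φ
Considered-id mono φ≗just =
  Considered-resp (sym ∘ φ≗just) mono (Considered↑⇒Considered mono considered-just)
  where
  considered-just : Considered true just
  considered-just = (λ x → x , refl) , (λ N → N , λ { x _ N≤x refl → N≤x }) ,
                    λ { x x′ _ _ x≤x′ refl refl → x≤x′ }

_∸out_ : PFun → ℕ → PFun
(φ ∸out c) x = mapM (_∸ c) (φ x)

_∸in_ : PFun → ℕ → PFun
(φ ∸in c) x = φ (x ∸ c)

∸out-just⁻¹ : ∀ φ c {x y′} → (φ ∸out c) x ≡ just y′ → Σ ℕ λ y → φ x ≡ just y × y′ ≡ y ∸ c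
∸out-just⁻¹ φ c {x} eq with φ x
... | just y = y , refl , sym (just-injective eq)

module _ {φ : PFun} (c : ℕ) where

  TotalP-∸out : TotalP φ → TotalP (φ ∸out c)
  TotalP-∸out tot x = let (y , φx≡y) = tot x in y ∸ c , cong (mapM (_∸ c)) φx≡y

  TendsInf-∸out : TendsInf φ → TendsInf (φ ∸out c)
  TendsInf-∸out lim N = let (M , M-spec) = lim (N + c) in M , λ x y′ M≤x eq →
    let (y , φx≡y , y′≡y∸c) = ∸out-just⁻¹ φ c eq
    in subst (N ≤_) (sym y′≡y∸c) (m+n≤o⇒m≤o∸n N (M-spec x y M≤x φx≡y))

  MonotoneP-∸out : MonotoneP φ → MonotoneP (φ ∸out c)
  MonotoneP-∸out mon x x′ z z′ x≤x′ e e′ =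
    let (y , φx≡y , z≡y∸c) = ∸out-just⁻¹ φ c e
        (y′ , φx′≡y′ , z′≡y′∸c) = ∸out-just⁻¹ φ c e′
    in subst₂ _≤_ (sym z≡y∸c) (sym z′≡y′∸c) (∸-monoˡ-≤ c (mon x x′ y y′ x≤x′ φx≡y φx′≡y′))

  Considered-∸out : ∀ mono → Considered mono φ → Considered mono (φ ∸out c)
  Considered-∸out = Considered-map TotalP-∸out TendsInf-∸out MonotoneP-∸out

  TendsInf-∸in : TendsInf φ → TendsInf (φ ∸in c)
  TendsInf-∸in lim N = let (M , M-spec) = lim N in
    M + c , λ x y M+c≤x → M-spec (x ∸ c) y (m+n≤o⇒m≤o∸n M M+c≤x)

  MonotoneP-∸in : MonotoneP φ → MonotoneP (φ ∸in c)
  MonotoneP-∸in mon x x′ y y′ x≤x′ = mon (x ∸ c) (x′ ∸ c) y y′ (∸-monoˡ-≤ c x≤x′)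

  Considered-∸in : ∀ mono → Considered mono φ → Considered mono (φ ∸in c)
  Considered-∸in = Considered-map (λ tot x → tot (x ∸ c)) TendsInf-∸in MonotoneP-∸in

m<o∸n⇒m+n<o : ∀ m n {o} → m < o ∸ n → m + n < o
m<o∸n⇒m+n<o m zero          lt rewrite +-identityʳ m = lt
m<o∸n⇒m+n<o m (suc n) {zero} ()
m<o∸n⇒m+n<o m (suc n) {suc o} lt rewrite +-suc m n = s≤s (m<o∸n⇒m+n<o m n lt)

Below-just : ∀ {a b} → Below a just b → a < b
Below-just (y , refl , a<b) = a<b

Below-∸out : ∀ {a b} φ c → Below a (φ ∸out c) b → Below (a + c) φ b
Below-∸out {a} φ c (y′ , eq , a<y′) =
  let (y , φb≡y , y′≡y∸c) = ∸out-just⁻¹ φ c eq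
  in y , φb≡y , m<o∸n⇒m+n<o a c (subst (a <_) y′≡y∸c a<y′)

Below-monoˡ : ∀ {a a′ b} φ → a′ ≤ a → Below a φ b → Below a′ φ b
Below-monoˡ φ a′≤a (y , φb≡y , a<y) = y , φb≡y , ≤-<-trans a′≤a a<y

Below-monoʳ : ∀ {a b b′ φ} → TotalP φ → MonotoneP φ → b ≤ b′ → Below a φ b → Below a φ b′
Below-monoʳ {b = b} {b′} tot mon b≤b′ (y , φb≡y , a<y) =
  let (y′ , φb′≡y′) = tot b′ in y′ , φb′≡y′ , <-≤-trans a<y (mon b b′ y y′ b≤b′ φb≡y φb′≡y′)

-- The new witnesses are ℓ₂ ∘ λ(τ i) ∘ ℓ₁: reindex φ along τ, refine the source
-- set first and the resulting target set afterwards.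
Prec-transport : ∀ {S} mono {Φ Ψ} 𝒞 𝒟 𝒞′ 𝒟′ {f g f′ g′ P Q} τ → TotRec₁ τ →
  (∀ i → Considered mono (Ψ i) → Considered mono (Φ (τ i))) →
  RecRefinement (WC S 𝒞′) (WC S 𝒞) P → RecRefinement (WC S 𝒟) (WC S 𝒟′) Q →
  (∀ i → Considered mono (Ψ i) → ∀ x →
     P x → LtApp f g (Φ (τ i)) x → Q x → LtApp f′ g′ (Ψ i) x) →
  Prec S mono Φ 𝒞 𝒟 f g → Prec S mono Ψ 𝒞′ 𝒟′ f′ g′
Prec-transport mono 𝒞 𝒟 _ _ τ τ-rec τ-cons (ℓ₁ , ℓ₁-rec , r₁) (ℓ₂ , ℓ₂-rec , r₂) below
               f≺g@(_ , λ₂ , λ₂-rec , uniform₂) =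
  (λ i i-cons →
     let (ℓ , ℓ-rec , r) = Prec-refinement mono 𝒞 𝒟 f≺g (τ i) (τ-cons i i-cons)
     in ℓ₂ ∘ ℓ ∘ ℓ₁ , TotRec₁-∘ ℓ₂-rec (TotRec₁-∘ ℓ-rec ℓ₁-rec) ,
        refine (Refines-weaken (λ x ((p , lt) , q) → below i i-cons x p lt q)
                  (Refines-∘ (Refines-∘ r₁ r) r₂))) ,
  (λ i j → ℓ₂ (λ₂ (τ i) (ℓ₁ j))) , TotRec₁-∘₂ ℓ₂-rec (TotRec₂-∘ λ₂-rec τ-rec ℓ₁-rec) ,
  λ i j i-cons →
    let r = refines {ℓ = λ₂ (τ i)} λ j′ → uniform₂ (τ i) j′ (τ-cons i i-cons)
    in refine (Refines-weaken (λ x ((p , lt) , q) → below i i-cons x p lt q)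
                 (Refines-∘ (Refines-∘ r₁ r) r₂)) j

≤ct-trans : ∀ {e f g} → e ≤ct f → f ≤ct g → e ≤ct g
≤ct-trans {g = g} (c , e≤f+c) (d , f≤g+d) = d + c , λ x →
  ≤-trans (e≤f+c x) (≤-trans (+-monoˡ-≤ c (f≤g+d x)) (≤-reflexive (+-assoc (g x) d c)))

module _ {S : Setting} where

  ≤ct-LL-trans : ∀ mono {Γ} 𝒞 𝒟 {e f g} → FamOK Γ →
    e ≤ct f → LL S mono Γ 𝒞 𝒟 f g → LL S mono Γ 𝒞 𝒟 e g
  ≤ct-LL-trans mono {Γ} 𝒞 𝒟 {e} {f} {g} ok (c , e≤f+c) (f≺g , f≤g) =
    Prec-transport mono 𝒞 𝒟 𝒞 𝒟 (λ i → θ i c) (TotRec₂-fixʳ c θ-rec)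
      (λ i → Considered-resp (sym ∘ θ-spec i c) mono ∘ Considered-∸out c mono)
      RecRefinement-id RecRefinement-id (λ i _ x _ lt _ → below i x lt) f≺g ,
    ≤ct-trans (c , e≤f+c) f≤g
    where
    open FamOK ok
    below : ∀ i x → LtApp f g (Γ (θ i c)) x → LtApp e g (Γ i) x
    below i x lt =
      Below-monoˡ (Γ i) (e≤f+c x) (Below-∸out (Γ i) c (Below-resp (θ-spec i c) lt))

  LL↑-≤ct-trans : ∀ {Γ} 𝒞 𝒟 {f g h} → FamOK Γ →
    LL S true Γ 𝒞 𝒟 f g → g ≤ct h → LL S true Γ 𝒞 𝒟 f h
  LL↑-≤ct-trans {Γ} 𝒞 𝒟 {f} {g} {h} ok (f≺g , f≤g) (d , g≤h+d) =
    Prec-transport true 𝒞 𝒟 𝒞 𝒟 (λ i → ζ i d) (TotRec₂-fixʳ d ζ-rec)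
      (λ i → Considered-resp (sym ∘ ζ-spec i d) true ∘ Considered-∸in d true)
      RecRefinement-id RecRefinement-id (λ i i-cons x _ lt _ → below i i-cons x lt) f≺g ,
    ≤ct-trans f≤g (d , g≤h+d)
    where
    open FamOK ok
    below : ∀ i → Considered true (Γ i) → ∀ x → LtApp f g (Γ (ζ i d)) x → LtApp f h (Γ i) x
    below i (tot , _ , mon) x lt =
      Below-monoʳ tot mon (m≤n+o⇒m∸n≤o (g x) d (subst (g x ≤_) (+-comm (h x) d) (g≤h+d x)))
        (Below-resp (ζ-spec i d) lt)

  LL-transʳ : ∀ mono {Φ Γ} ℬ 𝒞 𝒟 {e f g} → FamOK Φ →
    LL S mono Φ ℬ 𝒞 e f → LL S mono Γ 𝒞 𝒟 f g → LL S mono Γ ℬ 𝒟 e g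
  LL-transʳ mono {Γ = Γ} ℬ 𝒞 𝒟 record { hasId = ι , ι-spec } (e≺f , e≤f) (f≺g , f≤g) =
    Prec-transport mono 𝒞 𝒟 ℬ 𝒟 id TotRec₁-id (λ _ → id)
      (Prec-refinement mono ℬ 𝒞 e≺f ι (Considered-id mono ι-spec)) RecRefinement-id
      (λ i _ x e<f lt _ → Below-monoˡ (Γ i) (<⇒≤ (Below-just (Below-resp ι-spec e<f))) lt)
      f≺g ,
    ≤ct-trans e≤f f≤g

  LL↑-transˡ : ∀ {Φ Γ} ℬ 𝒞 𝒟 {e f g} → FamOK Γ →
    LL S true Φ ℬ 𝒞 e f → LL S true Γ 𝒞 𝒟 f g → LL S true Φ ℬ 𝒟 e g
  LL↑-transˡ ℬ 𝒞 𝒟 record { hasId = ι , ι-spec } (e≺f , e≤f) (f≺g , f≤g) =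
    Prec-transport true ℬ 𝒞 ℬ 𝒟 id TotRec₁-id (λ _ → id)
      RecRefinement-id (Prec-refinement true 𝒞 𝒟 f≺g ι (Considered-id true ι-spec))
      (λ { i (tot , _ , mon) x _ lt f<g →
           Below-monoʳ tot mon (<⇒≤ (Below-just (Below-resp ι-spec f<g))) lt })
      e≺f ,
    ≤ct-trans e≤f f≤g

  Prec-witness : ∀ mono {Φ} 𝒞 𝒟 {f g} i → Considered mono (Φ i) →
    Prec S mono Φ 𝒞 𝒟 f g → Σ ℕ (LtApp f g (Φ i))
  Prec-witness mono 𝒞 _ i i-cons (_ , _ , _ , uniform₂) =
    let (j , j-inf) = WC-infinite S 𝒞
        (x , _ , lt) = InfSubsetOf-witness (uniform₂ i j i-cons j-inf)
    in x , lt

  Prec-irrefl : ∀ mono {Φ} 𝒞 𝒟 {f} → FamOK Φ → ¬ Prec S mono Φ 𝒞 𝒟 f f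
  Prec-irrefl mono 𝒞 𝒟 record { hasId = ι , ι-spec } f≺f =
    let (x , lt) = Prec-witness mono 𝒞 𝒟 ι (Considered-id mono ι-spec) f≺f
    in <-irrefl refl (Below-just (Below-resp ι-spec lt))

  Prec↑⇒≱ct : ∀ {Φ} 𝒞 𝒟 {f g} → FamOK Φ → Prec S true Φ 𝒞 𝒟 f g → ¬ (g ≤ct f)
  Prec↑⇒≱ct {Φ} 𝒞 𝒟 record { hasId = ι , ι-spec ; θ = θ ; θ-spec = θ-spec } f≺g (c , g≤f+c) =
    let (x , lt) = Prec-witness true 𝒞 𝒟 (θ ι c) θι-cons f≺g
    in <⇒≱ (Below-just (Below-resp ι-spec (Below-∸out (Φ ι) c (Below-resp (θ-spec ι c) lt))))
           (g≤f+c x)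
    where
    θι-cons : Considered true (Φ (θ ι c))
    θι-cons = Considered-resp (sym ∘ θ-spec ι c) true
                (Considered-∸out c true (Considered-id true ι-spec))

  LL-strictOrder : ∀ mono {Φ} 𝒞 𝒟 → FamOK Φ → StrictOrder (LL S mono Φ 𝒞 𝒟)
  LL-strictOrder mono 𝒞 𝒟 ok =
    (λ _ (f≺f , _) → Prec-irrefl mono 𝒞 𝒟 ok f≺f) ,
    (λ _ _ _ (_ , f≤g) g≪h → ≤ct-LL-trans mono 𝒞 𝒟 ok f≤g g≪h)

  LL⇒LL↑ : ∀ {Φ} 𝒞 𝒟 {f g} → LL S false Φ 𝒞 𝒟 f g → LL S true Φ 𝒞 𝒟 f g
  LL⇒LL↑ _ _ ((uniform , λ₂ , λ₂-rec , uniform₂) , f≤g) =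
    ((λ i → uniform i ∘ Considered↑⇒Considered false) ,
     λ₂ , λ₂-rec , λ i j → uniform₂ i j ∘ Considered↑⇒Considered false) ,
    f≤g

  LL↑⇒<ct : ∀ {Φ} 𝒞 𝒟 {f g} → FamOK Φ → LL S true Φ 𝒞 𝒟 f g → f <ct g
  LL↑⇒<ct 𝒞 𝒟 ok (f≺g , f≤g) = f≤g , Prec↑⇒≱ct 𝒞 𝒟 ok f≺g

  ≤ct∨LL⇒≤ct : ∀ {Φ} 𝒜 ℬ {e f} →
    e ≤ct f ⊎ LL S false Φ 𝒜 ℬ e f ⊎ LL S true Φ 𝒜 ℬ e f → e ≤ct f
  ≤ct∨LL⇒≤ct _ _ (inj₁ e≤f)               = e≤f
  ≤ct∨LL⇒≤ct _ _ (inj₂ (inj₁ (_ , e≤f))) = e≤f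
  ≤ct∨LL⇒≤ct _ _ (inj₂ (inj₂ (_ , e≤f))) = e≤f

mainTheorem2 : (S : Setting) (Φ Γ : Fam) → FamOK Φ → FamOK Γ →
    (𝒜 ℬ 𝒞 𝒟 : SynClass) (e f g h : ℕ → ℕ) →
      (LL S false Φ ℬ 𝒞 e f → LL S false Γ 𝒞 𝒟 f g → LL S false Γ ℬ 𝒟 e g)
      × (LL S true Φ ℬ 𝒞 e f → LL S true Γ 𝒞 𝒟 f g →
           LL S true Φ ℬ 𝒟 e g × LL S true Γ ℬ 𝒟 e g)
      × (e ≤ct f → LL S false Γ 𝒞 𝒟 f g → LL S false Γ 𝒞 𝒟 e g)
      × (e ≤ct f → LL S true Γ 𝒞 𝒟 f g → g ≤ct h → LL S true Γ 𝒞 𝒟 e h)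
      × ((e ≤ct f ⊎ LL S false Φ 𝒜 ℬ e f ⊎ LL S true Φ 𝒜 ℬ e f) →
           LL S false Γ 𝒞 𝒟 f g → LL S false Γ 𝒞 𝒟 e g)
      × ((e ≤ct f ⊎ LL S false Φ 𝒜 ℬ e f ⊎ LL S true Φ 𝒜 ℬ e f) →
           LL S true Γ 𝒞 𝒟 f g →
           (g ≤ct h ⊎ LL S false Φ 𝒜 ℬ g h ⊎ LL S true Φ 𝒜 ℬ g h) →
           LL S true Γ 𝒞 𝒟 e h)
      × StrictOrder (LL S false Φ 𝒞 𝒟)
      × StrictOrder (LL S true Φ 𝒞 𝒟)
      × (LL S false Φ 𝒞 𝒟 f g → LL S true Φ 𝒞 𝒟 f g)
      × (LL S true Φ 𝒞 𝒟 f g → f <ct g)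
mainTheorem2 S Φ Γ okΦ okΓ 𝒜 ℬ 𝒞 𝒟 e f g h =
  LL-transʳ false ℬ 𝒞 𝒟 okΦ ,
  (λ e≪f f≪g → LL↑-transˡ ℬ 𝒞 𝒟 okΓ e≪f f≪g , LL-transʳ true ℬ 𝒞 𝒟 okΦ e≪f f≪g) ,
  ≤ct-LL-trans false 𝒞 𝒟 okΓ ,
  ≤ct-LL↑-≤ct ,
  ≤ct-LL-trans false 𝒞 𝒟 okΓ ∘ ≤ct∨LL⇒≤ct 𝒜 ℬ ,
  (λ e≤f f≪g g≤h → ≤ct-LL↑-≤ct (≤ct∨LL⇒≤ct 𝒜 ℬ e≤f) f≪g (≤ct∨LL⇒≤ct 𝒜 ℬ g≤h)) ,
  LL-strictOrder false 𝒞 𝒟 okΦ ,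
  LL-strictOrder true 𝒞 𝒟 okΦ ,
  LL⇒LL↑ 𝒞 𝒟 ,
  LL↑⇒<ct 𝒞 𝒟 okΦ
  where
  ≤ct-LL↑-≤ct : e ≤ct f → LL S true Γ 𝒞 𝒟 f g → g ≤ct h → LL S true Γ 𝒞 𝒟 e h
  ≤ct-LL↑-≤ct e≤f f≪g g≤h = ≤ct-LL-trans true 𝒞 𝒟 okΓ e≤f (LL↑-≤ct-trans 𝒞 𝒟 okΓ f≪g g≤h)
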